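{- Let $G\subseteq K$ be a graph such that $\mathcal{R}_G\neq\emptyset$ and let $e\in K\setminus G$. Assume that for some number $D>0$ and every $H\in\mathcal{R}_G$, the edge $e$ is contained in an alternating cycle (with respect to $H$) of length at most $2D$. Then $\mathcal{R}_{G,\neg e}\neq\emptyset$, $\mathcal{R}_{G,e}\neq\emptyset$, and $$\frac{1}{N^D-1}\le\frac{|\mathcal{R}_{G,\neg e}|}{|\mathcal{R}_{G,e}|}\le N^D-1.$$
   Context: $K=K_{n_1,n_2}$ is the complete bipartite graph with parts $V_1,V_2$, $|V_i|=n_i$, $N=n_1n_2$. Fix $p\in[0,1]$ with $pn_2,pn_1$ integers, and let $\mathcal{R}(n_1,n_2,p)$ be the set of subgraphs of $K$ in which every vertex of $V_1$ has degree $pn_2$ and every vertex of $V_2$ has degree $pn_1$. For $G\subseteq K$ let $\mathcal{R}_G=\{H\in\mathcal{R}(n_1,n_2,p):G\subseteq H\}$, $\mathcal{R}_{G,e}=\{H\in\mathcal{R}_G:e\in H\}$, $\mathcal{R}_{G,\neg e}=\{H\in\mathcal{R}_G:e\notin H\}$. Given $H\in\mathcal{R}_G$, color the edges of $K\setminus G$: edges of $H\setminus G$ blue, edges of $K\setminus H$ red. A cycle in $K\setminus G$ is alternating if it is the union of a blue matching and a red matching (consecutive edges have different colors). -}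

module Defs where

open import Data.Nat using (ℕ; zero; suc; _+_; _*_; _≤_)
open import Data.Nat.DivMod using (_mod_)
open import Data.Bool using (Bool; true; false)
open import Data.Fin using (Fin; toℕ)
open import Data.Fin.Properties using (all?; any?)
open import Data.Vec using (Vec; []; _∷_; lookup)
open import Data.List using (List; []; _∷_; map; concatMap; filter; length)
open import Data.Product using (_×_; _,_; Σ; ∃; proj₁; proj₂)
open import Data.Sum using (_⊎_)
open import Function.Definitions using (Injective)
open import Relation.Nullary using (Dec; ¬_)
open import Relation.Nullary.Decidable using (_×-dec_)
open import Relation.Binary.PropositionalEquality using (_≡_; _≢_)
open import Data.Bool.Properties using () renaming (_≟_ to _≟B_)
open import Data.Nat.Properties using () renaming (_≟_ to _≟ℕ_)

-- A subgraph of K_{n₁,n₂} (parts V₁ = Fin n₁, V₂ = Fin n₂) is given by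
-- its adjacency matrix: H[i][j] = true iff the edge {i,j} is in H.
Graph : ℕ → ℕ → Set
Graph n₁ n₂ = Vec (Vec Bool n₂) n₁

Edge : ℕ → ℕ → Set
Edge n₁ n₂ = Fin n₁ × Fin n₂

_∈E_ : ∀ {n₁ n₂} → Edge n₁ n₂ → Graph n₁ n₂ → Set
(i , j) ∈E H = lookup (lookup H i) j ≡ true

_∉E_ : ∀ {n₁ n₂} → Edge n₁ n₂ → Graph n₁ n₂ → Set
(i , j) ∉E H = lookup (lookup H i) j ≡ false

_∈E?_ : ∀ {n₁ n₂} (e : Edge n₁ n₂) (H : Graph n₁ n₂) → Dec (e ∈E H)
(i , j) ∈E? H = lookup (lookup H i) j ≟B true

_⊆G_ : ∀ {n₁ n₂} → Graph n₁ n₂ → Graph n₁ n₂ → Set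
G ⊆G H = ∀ i j → (i , j) ∈E G → (i , j) ∈E H

_⊆G?_ : ∀ {n₁ n₂} (G H : Graph n₁ n₂) → Dec (G ⊆G H)
G ⊆G? H = all? λ i → all? λ j → impl ((i , j) ∈E? G) ((i , j) ∈E? H)
  where
  impl : ∀ {A B : Set} → Dec A → Dec B → Dec (A → B)
  impl a b = Relation.Nullary.Decidable._→-dec_ a b
    where import Relation.Nullary.Decidable

countTrue : ∀ {n} → Vec Bool n → ℕ
countTrue [] = 0
countTrue (true ∷ v) = suc (countTrue v)
countTrue (false ∷ v) = countTrue v

deg₁ : ∀ {n₁ n₂} → Graph n₁ n₂ → Fin n₁ → ℕ
deg₁ H i = countTrue (lookup H i)

column : ∀ {n₁ n₂} → Graph n₁ n₂ → Fin n₂ → Vec Bool n₁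
column [] j = []
column (r ∷ H) j = lookup r j ∷ column H j

deg₂ : ∀ {n₁ n₂} → Graph n₁ n₂ → Fin n₂ → ℕ
deg₂ H j = countTrue (column H j)

-- H ∈ R(n₁,n₂,p) where d₁ = p n₂ and d₂ = p n₁.
IsRegular : ∀ {n₁ n₂} (d₁ d₂ : ℕ) → Graph n₁ n₂ → Set
IsRegular d₁ d₂ H = (∀ i → deg₁ H i ≡ d₁) × (∀ j → deg₂ H j ≡ d₂)

isRegular? : ∀ {n₁ n₂} (d₁ d₂ : ℕ) (H : Graph n₁ n₂) → Dec (IsRegular d₁ d₂ H)
isRegular? d₁ d₂ H = all? (λ i → deg₁ H i ≟ℕ d₁) ×-dec all? (λ j → deg₂ H j ≟ℕ d₂)

allVecs : ∀ {A : Set} → List A → (n : ℕ) → List (Vec A n)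
allVecs xs zero = [] ∷ []
allVecs xs (suc n) = concatMap (λ x → map (x ∷_) (allVecs xs n)) xs

allGraphs : (n₁ n₂ : ℕ) → List (Graph n₁ n₂)
allGraphs n₁ n₂ = allVecs (allVecs (true ∷ false ∷ []) n₂) n₁

InR_ : ∀ {n₁ n₂} (d₁ d₂ : ℕ) (G H : Graph n₁ n₂) → Set
InR_ d₁ d₂ G H = IsRegular d₁ d₂ H × (G ⊆G H)

inR? : ∀ {n₁ n₂} (d₁ d₂ : ℕ) (G H : Graph n₁ n₂) → Dec (InR_ d₁ d₂ G H)
inR? d₁ d₂ G H = isRegular? d₁ d₂ H ×-dec (G ⊆G? H)

cardR : ∀ {n₁ n₂} (d₁ d₂ : ℕ) → Graph n₁ n₂ → ℕ
cardR {n₁} {n₂} d₁ d₂ G = length (filter (inR? d₁ d₂ G) (allGraphs n₁ n₂))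

cardRe : ∀ {n₁ n₂} (d₁ d₂ : ℕ) → Graph n₁ n₂ → Edge n₁ n₂ → ℕ
cardRe {n₁} {n₂} d₁ d₂ G e =
  length (filter (λ H → inR? d₁ d₂ G H ×-dec (e ∈E? H)) (allGraphs n₁ n₂))

cardR¬e : ∀ {n₁ n₂} (d₁ d₂ : ℕ) → Graph n₁ n₂ → Edge n₁ n₂ → ℕ
cardR¬e {n₁} {n₂} d₁ d₂ G e =
  length (filter (λ H → inR? d₁ d₂ G H ×-dec Relation.Nullary.¬? (e ∈E? H)) (allGraphs n₁ n₂))
  where import Relation.Nullary

next : ∀ {m} → Fin (suc m) → Fin (suc m)
next {m} i = suc (toℕ i) mod suc m

-- An alternating cycle of length 2(suc m) in K \ G w.r.t. H:
-- distinct vertices a₀,b₀,a₁,b₁,…,a_m,b_m of V₁,V₂ (m ≥ 1, so length ≥ 4),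
-- edges aᵢbᵢ and bᵢa_{i+1} (indices mod suc m), none of them in G,
-- and consecutive edges have different colours (blue = in H, red = not in H).
record AltCycle {n₁ n₂} (G H : Graph n₁ n₂) (m : ℕ) : Set where
  field
    a : Fin (suc m) → Fin n₁
    b : Fin (suc m) → Fin n₂
    nontrivial : 1 ≤ m
    a-inj : Injective _≡_ _≡_ a
    b-inj : Injective _≡_ _≡_ b
    notG₁ : ∀ i → (a i , b i) ∉E G
    notG₂ : ∀ i → (a (next i) , b i) ∉E G
    alt₁ : ∀ i → lookup (lookup H (a i)) (b i) ≢ lookup (lookup H (a (next i))) (b i)
    alt₂ : ∀ i → lookup (lookup H (a (next i))) (b i) ≢ lookup (lookup H (a (next i))) (b (next i))

_onCycle_ : ∀ {n₁ n₂} {G H : Graph n₁ n₂} {m} → Edge n₁ n₂ → AltCycle G H m → Set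
_onCycle_ {m = m} e C = ∃ λ (i : Fin (suc m)) → ((a i , b i) ≡ e) ⊎ ((a (next i) , b i) ≡ e)
  where open AltCycle C

{-# OPTIONS --safe #-}
-- For H ∈ R_G let C be an alternating cycle through e of length at most 2D. Exchanging the colours
-- along C, i.e. passing to H ⊕ C, keeps every degree (each vertex of C trades its blue cycle edge for
-- its red one), keeps G (C avoids G) and toggles e; so H ↦ H ⊕ C sends R_{G,e} into R_{G,¬e} and back,
-- and H is recovered from H ⊕ C and C. Hence each of |R_{G,e}|, |R_{G,¬e}| is at most the other times
-- the number of possible cycles. Rotating C so that it starts at the V₂-endpoint of e, a cycle of
-- length 2(m+1) is fixed by m+1 vertices of V₁ and m of V₂, which leaves
-- Σ_{m<D} n₁^{m+1} n₂^m ≤ N^D − 1 candidates.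
module Submission where

open import Defs
open import Data.Bool using (Bool; true; false; not; _xor_; if_then_else_)
open import Data.Bool.Properties
  using (xor-assoc; xor-same; xor-identityʳ; xor-comm; true-xor; ¬-not; not-¬)
open import Data.Empty using (⊥-elim)
open import Data.Fin using (Fin; toℕ; _≟_) renaming (zero to fzero; suc to fsuc)
open import Data.Fin.Permutation using (Permutation; _⟨$⟩ʳ_; transpose)
import Data.Fin.Permutation.Components as Transposition
open import Data.Fin.Properties using (toℕ-fromℕ<; toℕ-injective; toℕ<n; any?; injective⇒≤)
open import Data.Integer using (+_)
open import Data.List
  using (List; []; _∷_; map; _++_; concatMap; filter; length; cartesianProductWith; downFrom; allFin)
open import Data.List.Properties using (length-map; length-++; length-++-sucʳ; length-tabulate)
open import Data.List.Membership.Propositional using (_∈_)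
open import Data.List.Membership.Propositional.Properties
  using (∈-∃++; ∈-++⁻; ∈-++⁺ˡ; ∈-++⁺ʳ; ∈-filter⁺; ∈-filter⁻; ∈-cartesianProductWith⁺;
         ∈-concatMap⁺; ∈-downFrom⁺; ∈-allFin; ∈-length)
import Data.List.Relation.Unary.All as All
open import Data.List.Relation.Unary.All using ([]; _∷_)
import Data.List.Relation.Unary.Any as Any
open import Data.List.Relation.Unary.Any using (here; there)
open import Data.List.Relation.Unary.AllPairs using ([]; _∷_)
open import Data.List.Relation.Unary.Unique.Propositional using (Unique)
import Data.List.Relation.Unary.Unique.Propositional.Properties as Unique
open import Data.Nat using (ℕ; zero; suc; _+_; _*_; _∸_; _^_; _%_; _≤_; _<_; z≤n; s≤s)
open import Data.Nat.DivMod using (_mod_; %-distribˡ-+; m%n%n≡m%n; [m+n]%n≡m%n; m<n⇒m%n≡m)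
open import Data.Nat.Properties
  using (+-identityʳ; +-comm; +-assoc; *-comm; *-assoc; m∸n+n≡m; <⇒≤; <⇒≤pred;
         ≤-trans; ≤-reflexive; +-monoʳ-<; +-monoˡ-≤; *-monoˡ-≤; *-monoʳ-≤; module ≤-Reasoning;
         +-0-commutativeMonoid)
open import Algebra.Properties.CommutativeMonoid.Sum +-0-commutativeMonoid using (sum; sum-permute)
open import Data.Nat.Solver using (module +-*-Solver)
open import Data.Product using (_×_; _,_; Σ; ∃; ∃₂; proj₁; proj₂)
open import Data.Product.Properties using (≡-dec)
open import Data.Rational using (ℚ; _/_; 0ℚ; 1ℚ) renaming (_*_ to _*ℚ_; _≤_ to _≤ℚ_)
open import Data.Sum using (_⊎_; inj₁; inj₂)
open import Data.Vec using (Vec; []; _∷_; lookup; tabulate)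
open import Data.Vec.Properties using (∷-injective; lookup∘tabulate; tabulate∘lookup; tabulate-cong)
open import Function using (_∘_)
open import Function.Bundles using (_⇔_; mk⇔)
open import Relation.Nullary using (Dec; yes; no; does; ¬_)
open import Relation.Nullary.Decidable using (_⊎-dec_; dec-true; dec-false; does-⇔)
open import Relation.Unary using (Decidable)
open import Relation.Binary.PropositionalEquality
  using (_≡_; _≢_; _≗_; refl; sym; trans; cong; cong₂; subst; module ≡-Reasoning)

private
  variable
    A B C : Set
    k n₁ n₂ : ℕ

concatMap-map≡cartesianProductWith : (f : A → B → C) (xs : List A) (ys : List B) →
  concatMap (λ x → map (f x) ys) xs ≡ cartesianProductWith f xs ys
concatMap-map≡cartesianProductWith f []       ys = refl
concatMap-map≡cartesianProductWith f (x ∷ xs) ys =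
  cong (map (f x) ys ++_) (concatMap-map≡cartesianProductWith f xs ys)

length-cartesianProductWith : (f : A → B → C) (xs : List A) (ys : List B) →
  length (cartesianProductWith f xs ys) ≡ length xs * length ys
length-cartesianProductWith f []       ys = refl
length-cartesianProductWith f (x ∷ xs) ys = trans (length-++ (map (f x) ys))
  (cong₂ _+_ (length-map (f x) ys) (length-cartesianProductWith f xs ys))

allVecs-suc : (xs : List A) (n : ℕ) →
  allVecs xs (suc n) ≡ cartesianProductWith _∷_ xs (allVecs xs n)
allVecs-suc xs n = concatMap-map≡cartesianProductWith _∷_ xs (allVecs xs n)

∈-allVecs : {xs : List A} → (∀ x → x ∈ xs) → ∀ {n} (v : Vec A n) → v ∈ allVecs xs n
∈-allVecs ∈xs []              = here refl
∈-allVecs {xs = xs} ∈xs {suc n} (x ∷ v) = subst (x ∷ v ∈_) (sym (allVecs-suc xs n))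
  (∈-cartesianProductWith⁺ _∷_ (∈xs x) (∈-allVecs ∈xs v))

allVecs⁺ : {xs : List A} → Unique xs → ∀ n → Unique (allVecs xs n)
allVecs⁺ u zero    = [] ∷ []
allVecs⁺ {xs = xs} u (suc n) = subst Unique (sym (allVecs-suc xs n))
  (Unique.cartesianProductWith⁺ _∷_ ∷-injective u (allVecs⁺ u n))

length-allVecs : (xs : List A) (n : ℕ) → length (allVecs xs n) ≡ length xs ^ n
length-allVecs xs zero    = refl
length-allVecs xs (suc n) = trans (cong length (allVecs-suc xs n))
  (trans (length-cartesianProductWith _∷_ xs (allVecs xs n)) (cong (length xs *_) (length-allVecs xs n)))

bools : List Bool
bools = true ∷ false ∷ []

∈-bools : ∀ b → b ∈ bools
∈-bools true  = here refl
∈-bools false = there (here refl)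

∈-allGraphs : (H : Graph n₁ n₂) → H ∈ allGraphs n₁ n₂
∈-allGraphs = ∈-allVecs (∈-allVecs ∈-bools)

allGraphs⁺ : ∀ n₁ n₂ → Unique (allGraphs n₁ n₂)
allGraphs⁺ n₁ n₂ = allVecs⁺ (allVecs⁺ (((λ ()) ∷ []) ∷ [] ∷ []) n₂) n₁

Unique-⊆⇒length≤ : {xs ys : List A} → Unique xs → (∀ {x} → x ∈ xs → x ∈ ys) →
  length xs ≤ length ys
Unique-⊆⇒length≤ {xs = []} _ _ = z≤n
Unique-⊆⇒length≤ {xs = x ∷ xs} (x∉xs ∷ u) xs⊆ys with ∈-∃++ (xs⊆ys (here refl))
... | ys₁ , ys₂ , refl = subst (suc (length xs) ≤_) (sym (length-++-sucʳ ys₁ x ys₂))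
  (s≤s (Unique-⊆⇒length≤ u xs⊆ys₁++ys₂))
  where
  xs⊆ys₁++ys₂ : ∀ {z} → z ∈ xs → z ∈ ys₁ ++ ys₂
  xs⊆ys₁++ys₂ z∈xs with ∈-++⁻ ys₁ (xs⊆ys (there z∈xs))
  ... | inj₁ z∈ys₁         = ∈-++⁺ˡ z∈ys₁
  ... | inj₂ (here refl)   = ⊥-elim (All.lookup x∉xs z∈xs refl)
  ... | inj₂ (there z∈ys₂) = ∈-++⁺ʳ ys₁ z∈ys₂

length-filter-≤-* : {P Q : A → Set} (P? : Decidable P) (Q? : Decidable Q) {xs : List A} →
  Unique xs → (∀ x → x ∈ xs) → (_∙_ : A → B → A) (ys : List B) →
  (∀ x → P x → ∃₂ λ y s → Q y × s ∈ ys × y ∙ s ≡ x) →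
  length (filter P? xs) ≤ length (filter Q? xs) * length ys
length-filter-≤-* P? Q? {xs} u ∈xs _∙_ ys cover = ≤-trans
  (Unique-⊆⇒length≤ (Unique.filter⁺ P? u) covered)
  (≤-reflexive (length-cartesianProductWith _∙_ (filter Q? xs) ys))
  where
  covered : ∀ {x} → x ∈ filter P? xs → x ∈ cartesianProductWith _∙_ (filter Q? xs) ys
  covered x∈ with cover _ (proj₂ (∈-filter⁻ P? {xs = xs} x∈))
  ... | y , s , Qy , s∈ys , refl = ∈-cartesianProductWith⁺ _∙_ (∈-filter⁺ Q? (∈xs y) Qy) s∈ys

∃-∈-of-length>0 : {xs : List A} → 0 < length xs → ∃ λ x → x ∈ xs
∃-∈-of-length>0 {xs = x ∷ _} _ = x , here refl

does-true⁻ : {P : Set} (P? : Dec P) → does P? ≡ true → P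
does-true⁻ (yes p) _ = p

count : (Fin k → Bool) → ℕ
count f = countTrue (tabulate f)

count≡sum : (f : Fin k → Bool) → count f ≡ sum (λ x → if f x then 1 else 0)
count≡sum {zero}  f = refl
count≡sum {suc k} f with f fzero
... | true  = cong suc (count≡sum (f ∘ fsuc))
... | false = count≡sum (f ∘ fsuc)

count-cong : {f g : Fin k → Bool} → f ≗ g → count f ≡ count g
count-cong f≗g = cong countTrue (tabulate-cong f≗g)

count-permute : (f : Fin k → Bool) (π : Permutation k k) → count (f ∘ (π ⟨$⟩ʳ_)) ≡ count f
count-permute f π = begin
  count (f ∘ (π ⟨$⟩ʳ_))                              ≡⟨ count≡sum (f ∘ (π ⟨$⟩ʳ_)) ⟩
  sum (λ x → if f (π ⟨$⟩ʳ x) then 1 else 0)          ≡⟨ sum-permute (λ x → if f x then 1 else 0) π ⟨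
  sum (λ x → if f x then 1 else 0)                   ≡⟨ count≡sum f ⟨
  count f                                            ∎
  where open ≡-Reasoning

record SwapsTwo (f s : Fin k → Bool) : Set where
  field
    p q      : Fin k
    f-p≢f-q  : f p ≢ f q
    s-p      : s p ≡ true
    s-q      : s q ≡ true
    s-only   : ∀ x → s x ≡ true → x ≡ p ⊎ x ≡ q

xor-true : ∀ b → b xor true ≡ not b
xor-true b = trans (xor-comm b true) (true-xor b)

xor-SwapsTwo≗transpose : {f s : Fin k → Bool} (sw : SwapsTwo f s) →
  ∀ x → f x xor s x ≡ f (Transposition.transpose (SwapsTwo.p sw) (SwapsTwo.q sw) x)
xor-SwapsTwo≗transpose {f = f} {s}
  record { p = p ; q = q ; f-p≢f-q = f-p≢f-q ; s-p = s-p ; s-q = s-q ; s-only = s-only } x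
  with x ≟ p
... | yes refl = trans (cong (f x xor_) s-p) (trans (xor-true (f x)) (sym (¬-not (f-p≢f-q ∘ sym))))
... | no x≢p with x ≟ q
...   | yes refl = trans (cong (f x xor_) s-q) (trans (xor-true (f x)) (sym (¬-not f-p≢f-q)))
...   | no x≢q with s x in sx
...     | false = xor-identityʳ (f x)
...     | true with s-only x sx
...       | inj₁ x≡p = ⊥-elim (x≢p x≡p)
...       | inj₂ x≡q = ⊥-elim (x≢q x≡q)

count-xor : {f s : Fin k → Bool} → (∀ x → s x ≡ false) ⊎ SwapsTwo f s →
  count (λ x → f x xor s x) ≡ count f
count-xor {f = f} (inj₁ s≡false) =
  count-cong λ x → trans (cong (f x xor_) (s≡false x)) (xor-identityʳ (f x))
count-xor {f = f} (inj₂ sw)      =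
  trans (count-cong (xor-SwapsTwo≗transpose sw)) (count-permute f (transpose p q))
  where open SwapsTwo sw

entry : Graph n₁ n₂ → Fin n₁ → Fin n₂ → Bool
entry H u v = lookup (lookup H u) v

graph : (Fin n₁ → Fin n₂ → Bool) → Graph n₁ n₂
graph F = tabulate λ u → tabulate (F u)

entry-graph : (F : Fin n₁ → Fin n₂ → Bool) → ∀ u v → entry (graph F) u v ≡ F u v
entry-graph F u v =
  trans (cong (λ r → lookup r v) (lookup∘tabulate (tabulate ∘ F) u)) (lookup∘tabulate (F u) v)

graph-entry : (H : Graph n₁ n₂) → graph (entry H) ≡ H
graph-entry H = trans (tabulate-cong (tabulate∘lookup ∘ lookup H)) (tabulate∘lookup H)

entry-injective : {H H′ : Graph n₁ n₂} → (∀ u v → entry H u v ≡ entry H′ u v) → H ≡ H′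
entry-injective {H = H} {H′} eq = begin
  H              ≡⟨ graph-entry H ⟨
  graph (entry H)  ≡⟨ tabulate-cong (λ u → tabulate-cong (eq u)) ⟩
  graph (entry H′) ≡⟨ graph-entry H′ ⟩
  H′             ∎
  where open ≡-Reasoning

infixl 6 _⊕_
_⊕_ : Graph n₁ n₂ → Graph n₁ n₂ → Graph n₁ n₂
H ⊕ S = graph λ u v → entry H u v xor entry S u v

entry-⊕ : (H S : Graph n₁ n₂) → ∀ u v → entry (H ⊕ S) u v ≡ entry H u v xor entry S u v
entry-⊕ H S = entry-graph _

⊕-cancelʳ : (H S : Graph n₁ n₂) → H ⊕ S ⊕ S ≡ H
⊕-cancelʳ H S = entry-injective λ u v → begin
  entry (H ⊕ S ⊕ S) u v                      ≡⟨ entry-⊕ (H ⊕ S) S u v ⟩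
  entry (H ⊕ S) u v xor entry S u v            ≡⟨ cong (_xor entry S u v) (entry-⊕ H S u v) ⟩
  (entry H u v xor entry S u v) xor entry S u v ≡⟨ xor-assoc (entry H u v) _ _ ⟩
  entry H u v xor (entry S u v xor entry S u v) ≡⟨ cong (entry H u v xor_) (xor-same (entry S u v)) ⟩
  entry H u v xor false                      ≡⟨ xor-identityʳ (entry H u v) ⟩
  entry H u v                                ∎
  where open ≡-Reasoning

deg₁≡count : (H : Graph n₁ n₂) → ∀ u → deg₁ H u ≡ count (entry H u)
deg₁≡count H u = cong countTrue (sym (tabulate∘lookup (lookup H u)))

column≡tabulate : (H : Graph n₁ n₂) → ∀ v → column H v ≡ tabulate (λ u → entry H u v)
column≡tabulate []      v = refl
column≡tabulate (r ∷ H) v = cong (lookup r v ∷_) (column≡tabulate H v)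

deg₂≡count : (H : Graph n₁ n₂) → ∀ v → deg₂ H v ≡ count (λ u → entry H u v)
deg₂≡count H v = cong countTrue (column≡tabulate H v)

⊕-preserves-IsRegular : ∀ {d₁ d₂} (H S : Graph n₁ n₂) →
  (∀ u → (∀ v → entry S u v ≡ false) ⊎ SwapsTwo (entry H u) (entry S u)) →
  (∀ v → (∀ u → entry S u v ≡ false) ⊎ SwapsTwo (λ u → entry H u v) (λ u → entry S u v)) →
  IsRegular d₁ d₂ H → IsRegular d₁ d₂ (H ⊕ S)
⊕-preserves-IsRegular H S rows cols (reg₁ , reg₂) =
  (λ u → trans (deg₁-⊕ u) (reg₁ u)) , (λ v → trans (deg₂-⊕ v) (reg₂ v))
  where
  open ≡-Reasoning
  deg₁-⊕ : ∀ u → deg₁ (H ⊕ S) u ≡ deg₁ H u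
  deg₁-⊕ u = begin
    deg₁ (H ⊕ S) u                              ≡⟨ deg₁≡count (H ⊕ S) u ⟩
    count (entry (H ⊕ S) u)                     ≡⟨ count-cong (entry-⊕ H S u) ⟩
    count (λ v → entry H u v xor entry S u v)   ≡⟨ count-xor (rows u) ⟩
    count (entry H u)                           ≡⟨ deg₁≡count H u ⟨
    deg₁ H u                                    ∎
  deg₂-⊕ : ∀ v → deg₂ (H ⊕ S) v ≡ deg₂ H v
  deg₂-⊕ v = begin
    deg₂ (H ⊕ S) v                              ≡⟨ deg₂≡count (H ⊕ S) v ⟩
    count (λ u → entry (H ⊕ S) u v)             ≡⟨ count-cong (λ u → entry-⊕ H S u v) ⟩
    count (λ u → entry H u v xor entry S u v)   ≡⟨ count-xor (cols v) ⟩
    count (λ u → entry H u v)                   ≡⟨ deg₂≡count H v ⟨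
    deg₂ H v                                    ∎

module Cyclic (m : ℕ) where

  private
    n = suc m

  open ≡-Reasoning

  -- Defs.next is definitionally shift 1.
  shift : ℕ → Fin n → Fin n
  shift c i = (c + toℕ i) mod n

  toℕ-shift : ∀ c i → toℕ (shift c i) ≡ (c + toℕ i) % n
  toℕ-shift c i = toℕ-fromℕ< _

  shift-shift : ∀ c d i → shift c (shift d i) ≡ shift (c + d) i
  shift-shift c d i = toℕ-injective (begin
    toℕ (shift c (shift d i))       ≡⟨ toℕ-shift c (shift d i) ⟩
    (c + toℕ (shift d i)) % n       ≡⟨ cong (λ k → (c + k) % n) (toℕ-shift d i) ⟩
    (c + (d + toℕ i) % n) % n       ≡⟨ %-distribˡ-+ c _ n ⟩
    (c % n + (d + toℕ i) % n % n) % n ≡⟨ cong (λ k → (c % n + k) % n) (m%n%n≡m%n (d + toℕ i) n) ⟩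
    (c % n + (d + toℕ i) % n) % n   ≡⟨ %-distribˡ-+ c (d + toℕ i) n ⟨
    (c + (d + toℕ i)) % n           ≡⟨ cong (_% n) (+-assoc c d (toℕ i)) ⟨
    (c + d + toℕ i) % n             ≡⟨ toℕ-shift (c + d) i ⟨
    toℕ (shift (c + d) i)           ∎)

  shift-period : ∀ i → shift n i ≡ i
  shift-period i = toℕ-injective (begin
    toℕ (shift n i)  ≡⟨ toℕ-shift n i ⟩
    (n + toℕ i) % n  ≡⟨ cong (_% n) (+-comm n (toℕ i)) ⟩
    (toℕ i + n) % n  ≡⟨ [m+n]%n≡m%n (toℕ i) n ⟩
    toℕ i % n        ≡⟨ m<n⇒m%n≡m (toℕ<n i) ⟩
    toℕ i            ∎)

  shift-inverse : ∀ c d → c + d ≡ n → ∀ i → shift c (shift d i) ≡ i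
  shift-inverse c d c+d≡n i =
    trans (shift-shift c d i) (trans (cong (λ k → shift k i) c+d≡n) (shift-period i))

  prev : Fin n → Fin n
  prev = shift m

  next-prev : ∀ i → next (prev i) ≡ i
  next-prev = shift-inverse 1 m refl

  prev-next : ∀ i → prev (next i) ≡ i
  prev-next = shift-inverse m 1 (+-comm m 1)

  rotate : Fin n → Fin n → Fin n
  rotate k = shift (toℕ k)

  rotate-zero : ∀ k → rotate k fzero ≡ k
  rotate-zero k = toℕ-injective (trans (toℕ-shift (toℕ k) fzero)
    (trans (cong (_% n) (+-comm (toℕ k) 0)) (m<n⇒m%n≡m (toℕ<n k))))

  rotate-next : ∀ k i → rotate k (next i) ≡ next (rotate k i)
  rotate-next k i = begin
    shift (toℕ k) (shift 1 i) ≡⟨ shift-shift (toℕ k) 1 i ⟩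
    shift (toℕ k + 1) i       ≡⟨ cong (λ c → shift c i) (+-comm (toℕ k) 1) ⟩
    shift (1 + toℕ k) i       ≡⟨ shift-shift 1 (toℕ k) i ⟨
    shift 1 (shift (toℕ k) i) ∎

  rotate-injective : ∀ k {i j} → rotate k i ≡ rotate k j → i ≡ j
  rotate-injective k {i} {j} eq =
    trans (sym (unrotate i)) (trans (cong (shift (n ∸ toℕ k)) eq) (unrotate j))
    where
    unrotate : ∀ i → shift (n ∸ toℕ k) (rotate k i) ≡ i
    unrotate = shift-inverse (n ∸ toℕ k) (toℕ k) (m∸n+n≡m (<⇒≤ (toℕ<n k)))

private
  variable
    m : ℕ

CycleEdge : (Fin (suc m) → Fin n₁) → (Fin (suc m) → Fin n₂) → Edge n₁ n₂ → Set
CycleEdge {m} a b e = ∃ λ (i : Fin (suc m)) → ((a i , b i) ≡ e) ⊎ ((a (next i) , b i) ≡ e)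

cycleEdge? : (a : Fin (suc m) → Fin n₁) (b : Fin (suc m) → Fin n₂) → ∀ e → Dec (CycleEdge a b e)
cycleEdge? a b e = any? λ i → ((a i , b i) ≟ₑ e) ⊎-dec ((a (next i) , b i) ≟ₑ e)
  where _≟ₑ_ = ≡-dec _≟_ _≟_

cycleGraph : (Fin (suc m) → Fin n₁) → (Fin (suc m) → Fin n₂) → Graph n₁ n₂
cycleGraph a b = graph λ u v → does (cycleEdge? a b (u , v))

module _ (a : Fin (suc m) → Fin n₁) (b : Fin (suc m) → Fin n₂) {u : Fin n₁} {v : Fin n₂} where

  cycleGraph-true : CycleEdge a b (u , v) → entry (cycleGraph a b) u v ≡ true
  cycleGraph-true uv = trans (entry-graph _ u v) (dec-true (cycleEdge? a b (u , v)) uv)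

  cycleGraph-false : ¬ CycleEdge a b (u , v) → entry (cycleGraph a b) u v ≡ false
  cycleGraph-false ¬uv = trans (entry-graph _ u v) (dec-false (cycleEdge? a b (u , v)) ¬uv)

  cycleGraph-true⁻ : entry (cycleGraph a b) u v ≡ true → CycleEdge a b (u , v)
  cycleGraph-true⁻ uv = does-true⁻ (cycleEdge? a b (u , v)) (trans (sym (entry-graph _ u v)) uv)

CycleEdge-cong : {a a′ : Fin (suc m) → Fin n₁} {b b′ : Fin (suc m) → Fin n₂} →
  a ≗ a′ → b ≗ b′ → ∀ {e} → CycleEdge a b e → CycleEdge a′ b′ e
CycleEdge-cong a≗a′ b≗b′ (i , inj₁ eq) = i , inj₁ (trans (sym (cong₂ _,_ (a≗a′ i) (b≗b′ i))) eq)
CycleEdge-cong a≗a′ b≗b′ (i , inj₂ eq) =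
  i , inj₂ (trans (sym (cong₂ _,_ (a≗a′ (next i)) (b≗b′ i))) eq)

cycleGraph-cong : {a a′ : Fin (suc m) → Fin n₁} {b b′ : Fin (suc m) → Fin n₂} →
  a ≗ a′ → b ≗ b′ → cycleGraph a b ≡ cycleGraph a′ b′
cycleGraph-cong {a = a} {a′} {b} {b′} a≗a′ b≗b′ = entry-injective λ u v →
  trans (entry-graph _ u v) (trans (does-⇔ same-edges (cycleEdge? _ _ (u , v)) (cycleEdge? _ _ (u , v)))
    (sym (entry-graph _ u v)))
  where
  same-edges : ∀ {e} → CycleEdge a b e ⇔ CycleEdge a′ b′ e
  same-edges = mk⇔ (CycleEdge-cong a≗a′ b≗b′) (CycleEdge-cong (sym ∘ a≗a′) (sym ∘ b≗b′))

edges : {G H : Graph n₁ n₂} → AltCycle G H m → Graph n₁ n₂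
edges C = cycleGraph (AltCycle.a C) (AltCycle.b C)

module _ {G H : Graph n₁ n₂} (C : AltCycle G H m) where
  open AltCycle C
  open Cyclic m

  cycleGraph-row : ∀ u → (∀ v → entry (edges C) u v ≡ false) ⊎ SwapsTwo (entry H u) (entry (edges C) u)
  cycleGraph-row u with any? (λ i → a i ≟ u)
  ... | no u∉a = inj₁ λ v → cycleGraph-false a b λ
    { (i , inj₁ refl) → u∉a (i , refl)
    ; (i , inj₂ refl) → u∉a (next i , refl) }
  ... | yes (j , refl) = inj₂ record
    { p       = b j
    ; q       = b (prev j)
    ; f-p≢f-q = alt₂′ ∘ sym
    ; s-p     = cycleGraph-true a b (j , inj₁ refl)
    ; s-q     = cycleGraph-true a b (prev j , inj₂ (cong (λ i → a i , b (prev j)) (next-prev j)))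
    ; s-only  = only
    }
    where
    alt₂′ : entry H (a j) (b (prev j)) ≢ entry H (a j) (b j)
    alt₂′ = subst (λ i → entry H (a i) (b (prev j)) ≢ entry H (a i) (b i)) (next-prev j) (alt₂ (prev j))
    only : ∀ v → entry (edges C) (a j) v ≡ true → v ≡ b j ⊎ v ≡ b (prev j)
    only v jv with cycleGraph-true⁻ a b jv
    ... | i , inj₁ eq = inj₁ (trans (sym (cong proj₂ eq)) (cong b (a-inj (cong proj₁ eq))))
    ... | i , inj₂ eq = inj₂ (trans (sym (cong proj₂ eq))
                          (cong b (trans (sym (prev-next i)) (cong prev (a-inj (cong proj₁ eq))))))

  cycleGraph-column : ∀ v →
    (∀ u → entry (edges C) u v ≡ false) ⊎ SwapsTwo (λ u → entry H u v) (λ u → entry (edges C) u v)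
  cycleGraph-column v with any? (λ i → b i ≟ v)
  ... | no v∉b = inj₁ λ u → cycleGraph-false a b λ
    { (i , inj₁ refl) → v∉b (i , refl)
    ; (i , inj₂ refl) → v∉b (i , refl) }
  ... | yes (j , refl) = inj₂ record
    { p       = a j
    ; q       = a (next j)
    ; f-p≢f-q = alt₁ j
    ; s-p     = cycleGraph-true a b (j , inj₁ refl)
    ; s-q     = cycleGraph-true a b (j , inj₂ refl)
    ; s-only  = only
    }
    where
    only : ∀ u → entry (edges C) u (b j) ≡ true → u ≡ a j ⊎ u ≡ a (next j)
    only u uj with cycleGraph-true⁻ a b uj
    ... | i , inj₁ eq = inj₁ (trans (sym (cong proj₁ eq)) (cong a (b-inj (cong proj₂ eq))))
    ... | i , inj₂ eq = inj₂ (trans (sym (cong proj₁ eq)) (cong (a ∘ next) (b-inj (cong proj₂ eq))))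

  cycleGraph-disjoint : ∀ u v → (u , v) ∈E G → entry (edges C) u v ≡ false
  cycleGraph-disjoint u v uv∈G = cycleGraph-false a b λ
    { (i , inj₁ refl) → not-¬ uv∈G (notG₁ i)
    ; (i , inj₂ refl) → not-¬ uv∈G (notG₂ i) }

  rotateCycle : Fin (suc m) → AltCycle G H m
  rotateCycle k = record
    { a          = a ∘ rotate k
    ; b          = b ∘ rotate k
    ; nontrivial = nontrivial
    ; a-inj      = rotate-injective k ∘ a-inj
    ; b-inj      = rotate-injective k ∘ b-inj
    ; notG₁      = notG₁ ∘ rotate k
    ; notG₂      = λ i → subst (λ l → (a l , b (rotate k i)) ∉E G) (sym (rotate-next k i)) (notG₂ (rotate k i))
    ; alt₁       = λ i → subst (λ l → entry H (a (rotate k i)) (b (rotate k i)) ≢ entry H (a l) (b (rotate k i)))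
                                 (sym (rotate-next k i)) (alt₁ (rotate k i))
    ; alt₂       = λ i → subst (λ l → entry H (a l) (b (rotate k i)) ≢ entry H (a l) (b l))
                                 (sym (rotate-next k i)) (alt₂ (rotate k i))
    }

  rotate-onCycle : ∀ {e} → e onCycle C →
    Σ (AltCycle G H m) λ C′ → AltCycle.b C′ fzero ≡ proj₂ e × e onCycle C′
  rotate-onCycle (k , inj₁ eq) = rotateCycle k , trans (cong b (rotate-zero k)) (cong proj₂ eq) ,
    fzero , inj₁ (trans (cong (λ l → a l , b l) (rotate-zero k)) eq)
  rotate-onCycle (k , inj₂ eq) = rotateCycle k , trans (cong b (rotate-zero k)) (cong proj₂ eq) ,
    fzero , inj₂ (trans (cong₂ _,_ (cong a (trans (rotate-next k fzero) (cong next (rotate-zero k))))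
                                    (cong b (rotate-zero k))) eq)

  ⊕-edges-InR : ∀ {d₁ d₂} → InR_ d₁ d₂ G H → InR_ d₁ d₂ G (H ⊕ edges C)
  ⊕-edges-InR (regular , G⊆H) = ⊕-preserves-IsRegular H (edges C) cycleGraph-row cycleGraph-column regular ,
    λ u v uv∈G → trans (entry-⊕ H (edges C) u v)
      (trans (cong₂ _xor_ (G⊆H u v uv∈G) (cycleGraph-disjoint u v uv∈G)) refl)

  ⊕-edges-toggles : ∀ {u v} → (u , v) onCycle C → entry (H ⊕ edges C) u v ≡ not (entry H u v)
  ⊕-edges-toggles {u} {v} uv = trans (entry-⊕ H (edges C) u v)
    (trans (cong (entry H u v xor_) (cycleGraph-true a b uv)) (xor-true (entry H u v)))

-- The cycle a₀b₀…aₘbₘ (m < D) with b₀ = y is listed by its vertices a₀…aₘ and b₁…bₘ.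
rootedCycleGraphs : Fin n₂ → ℕ → List (Graph n₁ n₂)
rootedCycleGraphs {n₂ = n₂} {n₁ = n₁} y D = concatMap
  (λ m → cartesianProductWith (λ as bs → cycleGraph (lookup as) (lookup (y ∷ bs)))
           (allVecs (allFin n₁) (suc m)) (allVecs (allFin n₂) m))
  (downFrom D)

∈-rootedCycleGraphs : ∀ {m D} {y : Fin n₂} → suc m ≤ D →
  (a : Fin (suc m) → Fin n₁) (b : Fin (suc m) → Fin n₂) → b fzero ≡ y →
  cycleGraph a b ∈ rootedCycleGraphs y D
∈-rootedCycleGraphs {m = m} {y = y} m<D a b b₀≡y = ∈-concatMap⁺ _ (Any.map (λ { refl →
  subst (_∈ _) (cycleGraph-cong (lookup∘tabulate a) decode-b)
    (∈-cartesianProductWith⁺ _ (∈-allVecs ∈-allFin (tabulate a)) (∈-allVecs ∈-allFin (tabulate (λ i → b (fsuc i))))) })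
  (∈-downFrom⁺ m<D))
  where
  decode-b : ∀ i → lookup (y ∷ tabulate (λ i → b (fsuc i))) i ≡ b i
  decode-b fzero    = sym b₀≡y
  decode-b (fsuc i) = lookup∘tabulate (λ i → b (fsuc i)) i

^-distribʳ-* : ∀ x y k → (x * y) ^ k ≡ x ^ k * y ^ k
^-distribʳ-* x y zero    = refl
^-distribʳ-* x y (suc k) = trans (cong (x * y *_) (^-distribʳ-* x y k)) (interchange x y (x ^ k) (y ^ k))
  where
  open +-*-Solver
  interchange : ∀ x y X Y → x * y * (X * Y) ≡ x * X * (y * Y)
  interchange = solve 4 (λ x y X Y → x :* y :* (X :* Y) := x :* X :* (y :* Y)) refl

length-rootedCycleGraphs-suc : (y : Fin n₂) (D : ℕ) →
  length (rootedCycleGraphs {n₁ = n₁} y (suc D))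
    ≡ n₁ * (n₁ * n₂) ^ D + length (rootedCycleGraphs {n₁ = n₁} y D)
length-rootedCycleGraphs-suc {n₂} {n₁} y D =
  trans (length-++ (cartesianProductWith _ (allVecs (allFin n₁) (suc D)) (allVecs (allFin n₂) D)))
        (cong (_+ length (rootedCycleGraphs {n₁ = n₁} y D)) count-D)
  where
  open ≡-Reasoning
  count-D : length (cartesianProductWith (λ as bs → cycleGraph {n₁ = n₁} (lookup as) (lookup (y ∷ bs)))
                     (allVecs (allFin n₁) (suc D)) (allVecs (allFin n₂) D)) ≡ n₁ * (n₁ * n₂) ^ D
  count-D = begin
    length (cartesianProductWith _ (allVecs (allFin n₁) (suc D)) (allVecs (allFin n₂) D))
      ≡⟨ length-cartesianProductWith _ (allVecs (allFin n₁) (suc D)) (allVecs (allFin n₂) D) ⟩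
    length (allVecs (allFin n₁) (suc D)) * length (allVecs (allFin n₂) D)
      ≡⟨ cong₂ _*_ (length-allVecs (allFin n₁) (suc D)) (length-allVecs (allFin n₂) D) ⟩
    length (allFin n₁) ^ suc D * length (allFin n₂) ^ D
      ≡⟨ cong₂ (λ x y → x ^ suc D * y ^ D) (length-tabulate {n = n₁} _) (length-tabulate {n = n₂} _) ⟩
    n₁ * n₁ ^ D * n₂ ^ D
      ≡⟨ *-assoc n₁ (n₁ ^ D) (n₂ ^ D) ⟩
    n₁ * (n₁ ^ D * n₂ ^ D)
      ≡⟨ cong (n₁ *_) (^-distribʳ-* n₁ n₂ D) ⟨
    n₁ * (n₁ * n₂) ^ D ∎

length-rootedCycleGraphs< : 1 ≤ n₁ → 2 ≤ n₂ → (y : Fin n₂) (D : ℕ) →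
  length (rootedCycleGraphs {n₁ = n₁} y D) < (n₁ * n₂) ^ D
length-rootedCycleGraphs< _ _ y zero = s≤s z≤n
length-rootedCycleGraphs< {n₁} {n₂} 1≤n₁ 2≤n₂ y (suc D) = begin-strict
  length (rootedCycleGraphs {n₁ = n₁} y (suc D))      ≡⟨ length-rootedCycleGraphs-suc y D ⟩
  n₁ * X + length (rootedCycleGraphs {n₁ = n₁} y D)   <⟨ +-monoʳ-< (n₁ * X) (length-rootedCycleGraphs< 1≤n₁ 2≤n₂ y D) ⟩
  n₁ * X + X                                          ≡⟨ +-comm (n₁ * X) X ⟩
  suc n₁ * X                                          ≤⟨ *-monoˡ-≤ X suc-n₁≤n₁*n₂ ⟩
  n₁ * n₂ * X                                         ∎
  where
  open ≤-Reasoning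
  X = (n₁ * n₂) ^ D
  suc-n₁≤n₁*n₂ : suc n₁ ≤ n₁ * n₂
  suc-n₁≤n₁*n₂ = begin
    suc n₁   ≤⟨ +-monoˡ-≤ n₁ 1≤n₁ ⟩
    n₁ + n₁  ≡⟨ cong (_+_ n₁) (+-identityʳ n₁) ⟨
    2 * n₁   ≡⟨ *-comm 2 n₁ ⟩
    n₁ * 2   ≤⟨ *-monoʳ-≤ n₁ 2≤n₂ ⟩
    n₁ * n₂  ∎

inhabitant-of-0<cardR : ∀ d₁ d₂ (G : Graph n₁ n₂) → 0 < cardR d₁ d₂ G → ∃ (InR_ d₁ d₂ G)
inhabitant-of-0<cardR {n₁} {n₂} d₁ d₂ G 0<|R| with ∃-∈-of-length>0 0<|R|
... | H , H∈ = H , proj₂ (∈-filter⁻ (inR? d₁ d₂ G) {xs = allGraphs n₁ n₂} H∈)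

AltCycle⇒2≤n₂ : {G H : Graph n₁ n₂} → AltCycle G H m → 2 ≤ n₂
AltCycle⇒2≤n₂ C = ≤-trans (s≤s nontrivial) (injective⇒≤ b-inj)
  where open AltCycle C

module Switching (d₁ d₂ : ℕ) (G : Graph n₁ n₂) (i : Fin n₁) (j : Fin n₂)
  (switches : List (Graph n₁ n₂))
  (switch : ∀ H → InR_ d₁ d₂ G H →
            ∃ λ S → S ∈ switches × InR_ d₁ d₂ G (H ⊕ S) × entry (H ⊕ S) i j ≡ not (entry H i j)) where

  switch-flips : ∀ {b} H → InR_ d₁ d₂ G H → entry H i j ≡ b →
    ∃ λ S → S ∈ switches × InR_ d₁ d₂ G (H ⊕ S) × entry (H ⊕ S) i j ≡ not b
  switch-flips H r refl = switch H r

  cardRe≤cardR¬e*length : cardRe d₁ d₂ G (i , j) ≤ cardR¬e d₁ d₂ G (i , j) * length switches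
  cardRe≤cardR¬e*length = length-filter-≤-* _ _ (allGraphs⁺ n₁ n₂) ∈-allGraphs _⊕_ switches cover
    where
    cover : ∀ H → InR_ d₁ d₂ G H × entry H i j ≡ true →
      ∃ λ H′ → ∃ λ S → (InR_ d₁ d₂ G H′ × entry H′ i j ≢ true) × S ∈ switches × H′ ⊕ S ≡ H
    cover H (r , ij∈H) with switch-flips H r ij∈H
    ... | S , S∈ , r′ , ij∉H⊕S = H ⊕ S , S , (r′ , not-¬ ij∉H⊕S) , S∈ , ⊕-cancelʳ H S

  cardR¬e≤cardRe*length : cardR¬e d₁ d₂ G (i , j) ≤ cardRe d₁ d₂ G (i , j) * length switches
  cardR¬e≤cardRe*length = length-filter-≤-* _ _ (allGraphs⁺ n₁ n₂) ∈-allGraphs _⊕_ switches cover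
    where
    cover : ∀ H → InR_ d₁ d₂ G H × entry H i j ≢ true →
      ∃ λ H′ → ∃ λ S → (InR_ d₁ d₂ G H′ × entry H′ i j ≡ true) × S ∈ switches × H′ ⊕ S ≡ H
    cover H (r , ij∉H) with switch-flips H r (¬-not ij∉H)
    ... | S , S∈ , r′ , ij∈H⊕S = H ⊕ S , S , (r′ , ij∈H⊕S) , S∈ , ⊕-cancelʳ H S

  0<cardRe : ∀ H → InR_ d₁ d₂ G H → entry H i j ≡ true → 0 < cardRe d₁ d₂ G (i , j)
  0<cardRe H r ij∈H = ∈-length (∈-filter⁺ _ (∈-allGraphs H) (r , ij∈H))

  0<cardR¬e : ∀ H → InR_ d₁ d₂ G H → entry H i j ≡ false → 0 < cardR¬e d₁ d₂ G (i , j)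
  0<cardR¬e H r ij∉H = ∈-length (∈-filter⁺ _ (∈-allGraphs H) (r , not-¬ ij∉H))

  0<cardR⇒0<cardR¬e×0<cardRe : 0 < cardR d₁ d₂ G →
    0 < cardR¬e d₁ d₂ G (i , j) × 0 < cardRe d₁ d₂ G (i , j)
  0<cardR⇒0<cardR¬e×0<cardRe 0<|R| = by-colour (entry H i j) refl
    where
    H = proj₁ (inhabitant-of-0<cardR d₁ d₂ G 0<|R|)
    r = proj₂ (inhabitant-of-0<cardR d₁ d₂ G 0<|R|)
    by-colour : ∀ b → entry H i j ≡ b → 0 < cardR¬e d₁ d₂ G (i , j) × 0 < cardRe d₁ d₂ G (i , j)
    by-colour true ij∈H with switch-flips H r ij∈H
    ... | S , _ , r′ , ij∉H⊕S = 0<cardR¬e (H ⊕ S) r′ ij∉H⊕S , 0<cardRe H r ij∈H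
    by-colour false ij∉H with switch-flips H r ij∉H
    ... | S , _ , r′ , ij∈H⊕S = 0<cardR¬e H r ij∉H , 0<cardRe (H ⊕ S) r′ ij∈H⊕S

proposition4 : (n₁ n₂ : ℕ) (p : ℚ) (d₁ d₂ : ℕ)
    → 0ℚ ≤ℚ p → p ≤ℚ 1ℚ
    → p *ℚ (+ n₂ / 1) ≡ + d₁ / 1
    → p *ℚ (+ n₁ / 1) ≡ + d₂ / 1
    → (G : Graph n₁ n₂)
    → 0 < cardR d₁ d₂ G
    → (e : Edge n₁ n₂) → e ∉E G
    → (D : ℕ) → 0 < D
    → (∀ (H : Graph n₁ n₂) → InR_ d₁ d₂ G H
         → Σ ℕ λ m → suc m ≤ D × Σ (AltCycle G H m) λ C → e onCycle C)
    → 0 < cardR¬e d₁ d₂ G e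
      × 0 < cardRe d₁ d₂ G e
      × cardRe d₁ d₂ G e ≤ ((n₁ * n₂) ^ D ∸ 1) * cardR¬e d₁ d₂ G e
      × cardR¬e d₁ d₂ G e ≤ ((n₁ * n₂) ^ D ∸ 1) * cardRe d₁ d₂ G e
-- p enters only through the degrees d₁, d₂; e ∉ G and 0 < D are implied by the cycle hypothesis.
proposition4 n₁ n₂ _ d₁ d₂ _ _ _ _ G 0<|R| (i , j) _ D _ cycles =
  proj₁ nonempty , proj₂ nonempty , scale cardRe≤cardR¬e*length , scale cardR¬e≤cardRe*length
  where
  switch : ∀ H → InR_ d₁ d₂ G H →
    ∃ λ S → S ∈ rootedCycleGraphs j D × InR_ d₁ d₂ G (H ⊕ S) × entry (H ⊕ S) i j ≡ not (entry H i j)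
  switch H r with cycles H r
  ... | m , m<D , C , ij∈C with rotate-onCycle C ij∈C
  ... | C′ , b₀≡j , ij∈C′ =
    edges C′ , ∈-rootedCycleGraphs m<D (AltCycle.a C′) (AltCycle.b C′) b₀≡j ,
    ⊕-edges-InR C′ r , ⊕-edges-toggles C′ ij∈C′

  open Switching d₁ d₂ G i j (rootedCycleGraphs j D) switch

  nonempty : 0 < cardR¬e d₁ d₂ G (i , j) × 0 < cardRe d₁ d₂ G (i , j)
  nonempty = 0<cardR⇒0<cardR¬e×0<cardRe 0<|R|

  2≤n₂ : 2 ≤ n₂
  2≤n₂ with inhabitant-of-0<cardR d₁ d₂ G 0<|R|
  ... | H , r = AltCycle⇒2≤n₂ (proj₁ (proj₂ (proj₂ (cycles H r))))

  |switches|≤ : length (rootedCycleGraphs {n₁ = n₁} j D) ≤ (n₁ * n₂) ^ D ∸ 1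
  |switches|≤ = <⇒≤pred (length-rootedCycleGraphs< (≤-trans (s≤s z≤n) (toℕ<n i)) 2≤n₂ j D)

  scale : ∀ {x y} → x ≤ y * length (rootedCycleGraphs {n₁ = n₁} j D) →
    x ≤ ((n₁ * n₂) ^ D ∸ 1) * y
  scale {y = y} x≤ = ≤-trans x≤ (≤-trans (*-monoʳ-≤ y |switches|≤) (≤-reflexive (*-comm y _)))
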